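{- $2\mathrm{ST}\subsetneq\mathrm{ST}$.
   Context: Words and programs. Fix a finite alphabet $\Sigma\supseteq\{0,1\}$ and let $\mathbb{W}=\Sigma^*$ ($\epsilon$ the empty word, $|w|$ the length of $w$); $v\unlhd w$ means $w=u.v.u'$ for some words $u,u'$. Fix a set $\mathbb{V}$ of variables and a set of operators, each operator $\mathtt{op}$ having an arity $ar(\mathtt{op})\ge 0$ and a total function $[\![\mathtt{op}]\!]:\mathbb{W}^{ar(\mathtt{op})}\to\mathbb{W}$. With a single oracle symbol $\phi$: expressions $e::=x\mid \mathtt{op}(e_1,\dots,e_{ar(\mathtt{op})})\mid \phi(e_1\upharpoonright e_2)$; commands $c::=\mathtt{skip}\mid x:=e\mid c_1;c_2\mid \mathtt{if}(e)\{c_1\}\,\mathtt{else}\,\{c_0\}\mid \mathtt{while}(e)\{c\}$; programs $p_\phi::=c\ \mathtt{return}\ x$. Semantics. For $w\in\mathbb{W}$, $n\in\mathbb{N}$, $w_{\upharpoonright n}$ is $w$ truncated to its first $\min(n,|w|)$ symbols followed by a word $10^k$ making the length exactly $n+1$; $[\![\upharpoonright]\!](v,w)=v_{\upharpoonright |w|}$. An oracle is a total function $\phi:\mathbb{W}\to\mathbb{W}$. A store is a partial map $\mu:\mathbb{V}\to\mathbb{W}$; $\mu_0$ maps every variable to $\epsilon$. Given $\phi$, the deterministic big-step semantics is: $\mu\models x\to\mu(x)$; $\mu\models\mathtt{op}(\bar e)\to[\![\mathtt{op}]\!](\bar w)$ if $\mu\models e_i\to w_i$ for all $i$; $\mu\models\phi(e_1\upharpoonright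 e_2)\to\phi([\![\upharpoonright]\!](v,w))$ if $\mu\models e_1\to v$, $\mu\models e_2\to w$; $\mu\models\mathtt{skip}\to\mu$; $\mu\models x:=e\to\mu[x\leftarrow w]$ if $\mu\models e\to w$; $\mu\models c_1;c_2\to\mu_2$ if $\mu\models c_1\to\mu_1$ and $\mu_1\models c_2\to\mu_2$; $\mu\models\mathtt{if}(e)\{c_1\}\mathtt{else}\{c_0\}\to\mu'$ if $\mu\models e\to b$ with $b\in\{0,1\}$ and $\mu\models c_b\to\mu'$; $\mu\models\mathtt{while}(e)\{c\}\to\mu$ if $\mu\models e\to 0$; $\mu\models\mathtt{while}(e)\{c\}\to\mu'$ if $\mu\models e\to1$ and $\mu\models c;\mathtt{while}(e)\{c\}\to\mu'$; $\mu\models c\ \mathtt{return}\ x\to\mu'(x)$ if $\mu\models c\to\mu'$. A program whose variables are $x_1,\dots,x_n$ computes $[\![p_\phi]\!](w_1,\dots,w_n)=w$ iff $\mu_0[x_1\leftarrow w_1,\dots,x_n\leftarrow w_n]\models p_\phi\to w$; it is terminating if $[\![p_\phi]\!]$ is total for every oracle $\phi$. Operators. $\mathtt{op}$ is neutral if $ar(\mathtt{op})=0$, or $[\![\mathtt{op}]\!]$ takes values in $\{0,1\}$, or for all $\bar w$ there is $i$ with $[\![\mathtt{op}]\!](\bar w)\unlhd w_i$. $\mathtt{op}$ is positive if there is a constant $c$ with $|[\![\mathtt{op}]\!](\bar w)|\le\max_i|w_i|+c$ for all $\bar w$. Multi-tier typing. Tiers are natural numbers $\mathbf 0,\mathbf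 1,\dots$ with the usual order $\preceq$ (strict: $\prec$), $\vee=\max$, $\wedge=\min$. A variable typing environment $\Gamma$ maps variables to tiers; an operator typing environment $\Delta$ assigns to each operator $\mathtt{op}$ and tier $t$ a set $\Delta(\mathtt{op})(t)$ of types $t_1\to\dots\to t_{ar(\mathtt{op})}\to t'$. Judgments $\Gamma,\Delta\vdash b:(t,t_{in},t_{out})$ are derived by the rules (writing $\vdash$ for $\Gamma,\Delta\vdash$, all tiers arbitrary): (V) $\vdash x:(\Gamma(x),t_{in},t_{out})$; (OP) if $t_1\to\dots\to t_n\to t\in\Delta(\mathtt{op})(t_{in})$ and $\vdash e_i:(t_i,t_{in},t_{out})$ for all $i\le n=ar(\mathtt{op})$ then $\vdash\mathtt{op}(e_1,\dots,e_n):(t,t_{in},t_{out})$; (OR) if $\vdash e_1:(t,t_{in},t_{out})$, $\vdash e_2:(t_{out},t_{in},t_{out})$, $t\prec t_{in}$ and $t\preceq t_{out}$ then $\vdash\phi(e_1\upharpoonright e_2):(t,t_{in},t_{out})$; (SUB) for a command $c$, if $\vdash c:(t,t_{in},t_{out})$ then $\vdash c:(t+1,t_{in},t_{out})$; (SK) $\vdash\mathtt{skip}:(\mathbf0,t_{in},t_{out})$; (A) if $\vdash x:(t_1,t_{in},t_{out})$, $\vdash e:(t_2,t_{in},t_{out})$, $t_1\preceq t_2$ then $\vdash x:=e:(t_1,t_{in},t_{out})$; (S) if $\vdash c_1:\tau$ and $\vdash c_2:\tau$ then $\vdash c_1;c_2:\tau$; (C) if $\vdash e:\tau$, $\vdash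 c_1:\tau$, $\vdash c_0:\tau$ then $\vdash\mathtt{if}(e)\{c_1\}\mathtt{else}\{c_0\}:\tau$; (W) if $\vdash e:(t,t_{in},t_{out})$, $\vdash c:(t,t,t_{out})$ and $\mathbf1\preceq t\preceq t_{out}$ then $\vdash\mathtt{while}(e)\{c\}:(t,t_{in},t_{out})$; (W$_0$) if $\vdash e:(t,t_{in},t)$, $\vdash c:(t,t,t)$ and $\mathbf1\preceq t$ then $\vdash\mathtt{while}(e)\{c\}:(t,t_{in},\mathbf0)$. $\Delta$ is safe if for each operator $\mathtt{op}$ it types with $ar(\mathtt{op})>0$: $\mathtt{op}$ is neutral or positive, $[\![\mathtt{op}]\!]$ is polynomial-time computable, and for every tier $t_{in}$ and every $t_1\to\dots\to t_n\to t\in\Delta(\mathtt{op})(t_{in})$: $t\preceq\wedge_i t_i\preceq\vee_i t_i\preceq t_{in}$, and $t\prec t_{in}$ if $\mathtt{op}$ is positive but not neutral. A program $c\ \mathtt{return}\ x$ is safe if there are $\Gamma$, a safe $\Delta$ and tiers with $\Gamma,\Delta\vdash c:(t,t_{in},t_{out})$. $\mathrm{ST}$ is the set of safe and terminating programs. 2-tier typing. A 2-tier operator typing environment $\Delta$ assigns to each operator $\mathtt{op}$ a set $\Delta(\mathtt{op})$ of types $\alpha_1\to\dots\to\alpha_{ar(\mathtt{op})}\to\alpha$ with $\alpha_i,\alpha\in\{\mathbf0,\mathbf1\}$. Judgments $\Gamma,\Delta\vdash_2 b:\alpha$ ($\alpha,\beta\in\{\mathbf0,\mathbf1\}$) are derived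 by: (V$_2$) $\vdash_2 x:\Gamma(x)$; (OP$_2$) if $\vdash_2 e_i:\alpha_i$ for all $i$ and $\alpha_1\to\dots\to\alpha_n\to\alpha\in\Delta(\mathtt{op})$ then $\vdash_2\mathtt{op}(e_1,\dots,e_n):\alpha$; (A$_2$) if $\vdash_2 x:\alpha$, $\vdash_2 e:\beta$ and $\alpha\preceq\beta$ then $\vdash_2 x:=e:\alpha$; (SK$_2$) $\vdash_2\mathtt{skip}:\alpha$; (S$_2$) if $\vdash_2 c:\alpha$ and $\vdash_2 c':\beta$ then $\vdash_2 c;c':\alpha\vee\beta$; (C$_2$) if $\vdash_2 e:\alpha$, $\vdash_2 c:\alpha$, $\vdash_2 c':\alpha$ then $\vdash_2\mathtt{if}(e)\{c\}\mathtt{else}\{c'\}:\alpha$; (W$_2$) if $\vdash_2 e:\mathbf1$ and $\vdash_2 c:\alpha$ then $\vdash_2\mathtt{while}(e)\{c\}:\mathbf1$ (no rule for oracle calls). A program $c\ \mathtt{return}\ x$ is 2-tier safe if $\Gamma,\Delta\vdash_2 c:\alpha$ for some $\Gamma$ with values in $\{\mathbf0,\mathbf1\}$, some $\alpha$, and some 2-tier $\Delta$ such that for every $\mathtt{op}$ it types, $[\![\mathtt{op}]\!]$ is polynomial-time computable, $\mathtt{op}$ is positive or neutral, and every $\alpha_1\to\dots\to\alpha_n\to\alpha\in\Delta(\mathtt{op})$ satisfies $\alpha\preceq\wedge_i\alpha_i$, with $\alpha=\mathbf0$ if $\mathtt{op}$ is positive but not neutral. $2\mathrm{ST}$ is the set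 of 2-tier safe and terminating programs. -}

module Defs where

open import Data.Nat using (ℕ; zero; suc; _+_; _∸_; _≤_; _<_; _⊔_; _<ᵇ_)
open import Data.Fin using (Fin)
open import Data.List using (List; []; _∷_; _++_; length; take; replicate)
open import Data.Vec using (Vec; lookup; map; foldr)
open import Data.Product using (Σ; ∃; ∃-syntax; _×_; _,_)
open import Data.Sum using (_⊎_)
open import Relation.Nullary using (¬_)
open import Relation.Binary.PropositionalEquality using (_≡_)

record Setting : Set₁ where
  field
    k        : ℕ
    Op       : Set
    ar       : Op → ℕ
  Sym : Set
  Sym = Fin (suc (suc k))
  Word : Set
  Word = List Sym
  field
    ⟦_⟧op    : (o : Op) → Vec Word (ar o) → Word
    PolyTime : ∀ {n} → (Vec Word n → Word) → Set

module Lang (𝒮 : Setting) where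
  open Setting 𝒮 public

  𝟘 𝟙 : Sym
  𝟘 = Fin.zero
  𝟙 = Fin.suc Fin.zero

  w0 w1 : Word
  w0 = 𝟘 ∷ []
  w1 = 𝟙 ∷ []

  Var : Set
  Var = ℕ

  _⊴_ : Word → Word → Set
  v ⊴ w = ∃[ u ] ∃[ u' ] (w ≡ u ++ (v ++ u'))

  data Expr : Set where
    var : Var → Expr
    op  : (o : Op) → Vec Expr (ar o) → Expr
    orc : Expr → Expr → Expr

  data Cmd : Set where
    skip   : Cmd
    _:=_   : Var → Expr → Cmd
    _⨾_    : Cmd → Cmd → Cmd
    if_then_else_ : Expr → Cmd → Cmd → Cmd
    while  : Expr → Cmd → Cmd

  record Program : Set where
    constructor _return_
    field
      body : Cmd
      ret  : Var
  open Program public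

  _↾ₙ_ : Word → ℕ → Word
  w ↾ₙ n = take n w ++ (𝟙 ∷ replicate (n ∸ length w) 𝟘)

  ⟦↾⟧ : Word → Word → Word
  ⟦↾⟧ v w = v ↾ₙ length w

  Oracle : Set
  Oracle = Word → Word

  Store : Set
  Store = Var → Word

  μ₀ : Store
  μ₀ _ = []

  _[_←_] : Store → Var → Word → Store
  (μ [ x ← w ]) y with y Data.Nat.≟ x
  ... | Relation.Nullary.yes _ = w
  ... | Relation.Nullary.no  _ = μ y

  mutual
    data EvalE (φ : Oracle) (μ : Store) : Expr → Word → Set where
      ev-var : ∀ {x} → EvalE φ μ (var x) (μ x)
      ev-op  : ∀ {o es ws} → EvalEs φ μ es ws → EvalE φ μ (op o es) (⟦ o ⟧op ws)
      ev-orc : ∀ {e₁ e₂ v w} → EvalE φ μ e₁ v → EvalE φ μ e₂ w →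
               EvalE φ μ (orc e₁ e₂) (φ (⟦↾⟧ v w))

    data EvalEs (φ : Oracle) (μ : Store) : ∀ {n} → Vec Expr n → Vec Word n → Set where
      []  : EvalEs φ μ Vec.[] Vec.[]
      _∷_ : ∀ {n e w} {es : Vec Expr n} {ws} →
            EvalE φ μ e w → EvalEs φ μ es ws → EvalEs φ μ (e Vec.∷ es) (w Vec.∷ ws)

  data Exec (φ : Oracle) : Store → Cmd → Store → Set where
    ex-skip   : ∀ {μ} → Exec φ μ skip μ
    ex-assign : ∀ {μ x e w} → EvalE φ μ e w → Exec φ μ (x := e) (μ [ x ← w ])
    ex-seq    : ∀ {μ μ₁ μ₂ c₁ c₂} → Exec φ μ c₁ μ₁ → Exec φ μ₁ c₂ μ₂ →
                Exec φ μ (c₁ ⨾ c₂) μ₂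
    ex-if1    : ∀ {μ μ' e c₁ c₀} → EvalE φ μ e w1 → Exec φ μ c₁ μ' →
                Exec φ μ (if e then c₁ else c₀) μ'
    ex-if0    : ∀ {μ μ' e c₁ c₀} → EvalE φ μ e w0 → Exec φ μ c₀ μ' →
                Exec φ μ (if e then c₁ else c₀) μ'
    ex-while0 : ∀ {μ e c} → EvalE φ μ e w0 → Exec φ μ (while e c) μ
    ex-while1 : ∀ {μ μ' e c} → EvalE φ μ e w1 → Exec φ μ (c ⨾ while e c) μ' →
                Exec φ μ (while e c) μ'

  Run : Oracle → Store → Program → Word → Set
  Run φ μ p w = ∃[ μ' ] (Exec φ μ (body p) μ' × μ' (ret p) ≡ w)

  -- terminating: ⟦p_φ⟧ total for every oracle φ, i.e. an output exists
  -- for every assignment of input words to the variables (all other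
  -- variables are never read)
  Terminating : Program → Set
  Terminating p = ∀ (φ : Oracle) (μ : Store) → ∃[ w ] Run φ μ p w

  maxLen : ∀ {n} → Vec Word n → ℕ
  maxLen ws = foldr (λ _ → ℕ) _⊔_ 0 (map length ws)

  Neutral : Op → Set
  Neutral o = ar o ≡ 0
            ⊎ (∀ ws → ⟦ o ⟧op ws ≡ w0 ⊎ ⟦ o ⟧op ws ≡ w1)
            ⊎ (∀ ws → ∃[ i ] (⟦ o ⟧op ws ⊴ lookup ws i))

  Positive : Op → Set
  Positive o = ∃[ c ] (∀ ws → length (⟦ o ⟧op ws) ≤ maxLen ws + c)

  Tier : Set
  Tier = ℕ

  VarEnv : Set
  VarEnv = Var → Tier

  -- Δ(op)(t_in) as a predicate on types t₁ → … → tₙ → t, written (t̄ , t)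
  OpEnv : Set₁
  OpEnv = (o : Op) → Tier → Vec Tier (ar o) × Tier → Set

  module _ (Γ : VarEnv) (Δ : OpEnv) where
    mutual
      data TyE : Expr → Tier → Tier → Tier → Set where
        V  : ∀ {x tin tout} → TyE (var x) (Γ x) tin tout
        OP : ∀ {o es ts t tin tout} → Δ o tin (ts , t) → TyEs es ts tin tout →
             TyE (op o es) t tin tout
        OR : ∀ {e₁ e₂ t tin tout} → TyE e₁ t tin tout → TyE e₂ tout tin tout →
             t < tin → t ≤ tout → TyE (orc e₁ e₂) t tin tout

      data TyEs : ∀ {n} → Vec Expr n → Vec Tier n → Tier → Tier → Set where
        []  : ∀ {tin tout} → TyEs Vec.[] Vec.[] tin tout
        _∷_ : ∀ {n e t tin tout} {es : Vec Expr n} {ts} →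
              TyE e t tin tout → TyEs es ts tin tout →
              TyEs (e Vec.∷ es) (t Vec.∷ ts) tin tout

    data TyC : Cmd → Tier → Tier → Tier → Set where
      SUB : ∀ {c t tin tout} → TyC c t tin tout → TyC c (suc t) tin tout
      SK  : ∀ {tin tout} → TyC skip 0 tin tout
      A   : ∀ {x e t₁ t₂ tin tout} → TyE (var x) t₁ tin tout → TyE e t₂ tin tout →
            t₁ ≤ t₂ → TyC (x := e) t₁ tin tout
      S   : ∀ {c₁ c₂ t tin tout} → TyC c₁ t tin tout → TyC c₂ t tin tout →
            TyC (c₁ ⨾ c₂) t tin tout
      C   : ∀ {e c₁ c₀ t tin tout} → TyE e t tin tout → TyC c₁ t tin tout →
            TyC c₀ t tin tout → TyC (if e then c₁ else c₀) t tin tout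
      W   : ∀ {e c t tin tout} → TyE e t tin tout → TyC c t t tout →
            1 ≤ t → t ≤ tout → TyC (while e c) t tin tout
      W₀  : ∀ {e c t tin} → TyE e t tin t → TyC c t t t →
            1 ≤ t → TyC (while e c) t tin 0

  SafeOpEnv : OpEnv → Set
  SafeOpEnv Δ =
    ∀ (o : Op) → 0 < ar o → ∀ (tin : Tier) (ts : Vec Tier (ar o)) (t : Tier) →
      Δ o tin (ts , t) →
        (Neutral o ⊎ Positive o)
      × PolyTime (⟦ o ⟧op)
      × (∀ i → t ≤ lookup ts i)
      × (∀ i → lookup ts i ≤ tin)
      × (Positive o → ¬ Neutral o → t < tin)

  Safe : Program → Set₁
  Safe p = ∃[ Γ ] ∃[ Δ ] (SafeOpEnv Δ × ∃[ t ] ∃[ tin ] ∃[ tout ] TyC Γ Δ (body p) t tin tout)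

  ST : Program → Set₁
  ST p = Safe p × Terminating p

  data Tier₂ : Set where
    𝟎 𝟏 : Tier₂

  data _≼_ : Tier₂ → Tier₂ → Set where
    𝟎≼ : ∀ {α} → 𝟎 ≼ α
    𝟏≼𝟏 : 𝟏 ≼ 𝟏

  _∨₂_ : Tier₂ → Tier₂ → Tier₂
  𝟎 ∨₂ β = β
  𝟏 ∨₂ _ = 𝟏

  VarEnv₂ : Set
  VarEnv₂ = Var → Tier₂

  OpEnv₂ : Set₁
  OpEnv₂ = (o : Op) → Vec Tier₂ (ar o) × Tier₂ → Set

  module _ (Γ : VarEnv₂) (Δ : OpEnv₂) where
    mutual
      data TyE₂ : Expr → Tier₂ → Set where
        V₂  : ∀ {x} → TyE₂ (var x) (Γ x)
        OP₂ : ∀ {o es αs α} → TyEs₂ es αs → Δ o (αs , α) → TyE₂ (op o es) α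

      data TyEs₂ : ∀ {n} → Vec Expr n → Vec Tier₂ n → Set where
        []  : TyEs₂ Vec.[] Vec.[]
        _∷_ : ∀ {n e α} {es : Vec Expr n} {αs} →
              TyE₂ e α → TyEs₂ es αs → TyEs₂ (e Vec.∷ es) (α Vec.∷ αs)

    data TyC₂ : Cmd → Tier₂ → Set where
      A₂  : ∀ {x e α β} → TyE₂ (var x) α → TyE₂ e β → α ≼ β → TyC₂ (x := e) α
      SK₂ : ∀ {α} → TyC₂ skip α
      S₂  : ∀ {c c' α β} → TyC₂ c α → TyC₂ c' β → TyC₂ (c ⨾ c') (α ∨₂ β)
      C₂  : ∀ {e c c' α} → TyE₂ e α → TyC₂ c α → TyC₂ c' α →
            TyC₂ (if e then c else c') α
      W₂  : ∀ {e c α} → TyE₂ e 𝟏 → TyC₂ c α → TyC₂ (while e c) 𝟏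

  SafeOpEnv₂ : OpEnv₂ → Set
  SafeOpEnv₂ Δ =
    ∀ (o : Op) (αs : Vec Tier₂ (ar o)) (α : Tier₂) → Δ o (αs , α) →
        PolyTime (⟦ o ⟧op)
      × (Positive o ⊎ Neutral o)
      × (∀ i → α ≼ lookup αs i)
      × (Positive o → ¬ Neutral o → α ≡ 𝟎)

  Safe₂ : Program → Set₁
  Safe₂ p = ∃[ Γ ] ∃[ Δ ] (SafeOpEnv₂ Δ × ∃[ α ] TyC₂ Γ Δ (body p) α)

  2ST : Program → Set₁
  2ST p = Safe₂ p × Terminating p

-- A 2-tier derivation is a multi-tier derivation in disguise: read the tiers
-- 𝟎, 𝟏 as 0, 1 and type every expression and command with t_in = t_out = 1.
-- The operator side conditions then coincide, rule W applies with t = 1, and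
-- the join in the 2-tier sequencing rule is absorbed by subsumption (SUB).
-- The inclusion is strict because 2-tier typing has no rule for oracle calls,
-- whereas x := φ(x ↾ x) is typable with tiers t = t_out = 0 < t_in = 1.
module Submission where

open import Defs
open import Data.Product using (_×_; ∃-syntax; Σ-syntax; _,_)
open import Data.Sum using (swap)
open import Data.Empty using (⊥)
open import Data.Nat using (_≤_; _<_; _≤′_; ≤′-refl; ≤′-step; z≤n; s≤s)
open import Data.Nat.Properties using (≤⇒≤′)
open import Data.Vec using (Vec; lookup; map)
open import Data.Vec.Properties using (lookup-map)
open import Relation.Nullary using (¬_)
open import Relation.Binary.PropositionalEquality using (_≡_; refl; sym; subst)

module TierFacts (𝒮 : Setting) where
  open Lang 𝒮

  TyC-weaken : ∀ {Γ Δ c t t' tin tout} → t ≤ t' →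
               TyC Γ Δ c t tin tout → TyC Γ Δ c t' tin tout
  TyC-weaken t≤t' = go (≤⇒≤′ t≤t')
    where
    go : ∀ {Γ Δ c t t' tin tout} → t ≤′ t' →
         TyC Γ Δ c t tin tout → TyC Γ Δ c t' tin tout
    go ≤′-refl         d = d
    go (≤′-step t≤′t') d = SUB (go t≤′t' d)

  ≼-∨₂ˡ : ∀ α β → α ≼ (α ∨₂ β)
  ≼-∨₂ˡ 𝟎 β = 𝟎≼
  ≼-∨₂ˡ 𝟏 β = 𝟏≼𝟏

  ≼-refl : ∀ α → α ≼ α
  ≼-refl 𝟎 = 𝟎≼
  ≼-refl 𝟏 = 𝟏≼𝟏

  ≼-∨₂ʳ : ∀ α β → β ≼ (α ∨₂ β)
  ≼-∨₂ʳ 𝟎 β = ≼-refl β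
  ≼-∨₂ʳ 𝟏 𝟎 = 𝟎≼
  ≼-∨₂ʳ 𝟏 𝟏 = 𝟏≼𝟏

  ¬TyE₂-orc : ∀ {Γ Δ e₁ e₂ α} → ¬ TyE₂ Γ Δ (orc e₁ e₂) α
  ¬TyE₂-orc ()

module TwoTierEmbedding (𝒮 : Setting) where
  open Lang 𝒮
  open TierFacts 𝒮

  toTier : Tier₂ → Tier
  toTier 𝟎 = 0
  toTier 𝟏 = 1

  toTier-≤1 : ∀ α → toTier α ≤ 1
  toTier-≤1 𝟎 = z≤n
  toTier-≤1 𝟏 = s≤s z≤n

  toTier-mono : ∀ {α β} → α ≼ β → toTier α ≤ toTier β
  toTier-mono 𝟎≼  = z≤n
  toTier-mono 𝟏≼𝟏 = s≤s z≤n

  embedVarEnv : VarEnv₂ → VarEnv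
  embedVarEnv Γ x = toTier (Γ x)

  embedOpEnv : OpEnv₂ → OpEnv
  embedOpEnv Δ o tin (ts , t) = Σ[ αs ∈ Vec Tier₂ (ar o) ] Σ[ α ∈ Tier₂ ]
    (Δ o (αs , α) × tin ≡ 1 × ts ≡ map toTier αs × t ≡ toTier α)

  embedOpEnv-safe : ∀ {Δ} → SafeOpEnv₂ Δ → SafeOpEnv (embedOpEnv Δ)
  embedOpEnv-safe safe o _ _ _ _ (αs , α , δ , refl , refl , refl)
    with safe o αs α δ
  ... | polyTime , posOrNeutral , α≼αs , positive⇒𝟎 =
    swap posOrNeutral , polyTime , below , atMostOne , positive⇒<1
    where
    below : ∀ i → toTier α ≤ lookup (map toTier αs) i
    below i = subst (toTier α ≤_) (sym (lookup-map i toTier αs)) (toTier-mono (α≼αs i))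

    atMostOne : ∀ i → lookup (map toTier αs) i ≤ 1
    atMostOne i = subst (_≤ 1) (sym (lookup-map i toTier αs)) (toTier-≤1 (lookup αs i))

    positive⇒<1 : Positive o → ¬ Neutral o → toTier α < 1
    positive⇒<1 pos ¬neu with positive⇒𝟎 pos ¬neu
    ... | refl = s≤s z≤n

  module _ (Γ : VarEnv₂) (Δ : OpEnv₂) where
    private
      Γ′ = embedVarEnv Γ
      Δ′ = embedOpEnv Δ

    mutual
      embedTyE : ∀ {e α} → TyE₂ Γ Δ e α → TyE Γ′ Δ′ e (toTier α) 1 1
      embedTyE V₂                            = V
      embedTyE (OP₂ {αs = αs} {α = α} ⊢es δ) = OP (αs , α , δ , refl , refl , refl) (embedTyEs ⊢es)

      embedTyEs : ∀ {n} {es : Vec Expr n} {αs} →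
                  TyEs₂ Γ Δ es αs → TyEs Γ′ Δ′ es (map toTier αs) 1 1
      embedTyEs []          = []
      embedTyEs (⊢e ∷ ⊢es) = embedTyE ⊢e ∷ embedTyEs ⊢es

    embedTyC : ∀ {c α} → TyC₂ Γ Δ c α → TyC Γ′ Δ′ c (toTier α) 1 1
    embedTyC (A₂ V₂ ⊢e α≼β)          = A V (embedTyE ⊢e) (toTier-mono α≼β)
    embedTyC {α = α} SK₂              = TyC-weaken (z≤n {toTier α}) SK
    embedTyC (S₂ {α = α} {β} ⊢c ⊢c′) =
      S (TyC-weaken (toTier-mono (≼-∨₂ˡ α β)) (embedTyC ⊢c))
        (TyC-weaken (toTier-mono (≼-∨₂ʳ α β)) (embedTyC ⊢c′))
    embedTyC (C₂ ⊢e ⊢c ⊢c′)          = C (embedTyE ⊢e) (embedTyC ⊢c) (embedTyC ⊢c′)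
    embedTyC (W₂ {α = α} ⊢e ⊢c)      =
      W (embedTyE ⊢e) (TyC-weaken (toTier-≤1 α) (embedTyC ⊢c)) (s≤s z≤n) (s≤s z≤n)

  2ST⊆ST : ∀ p → 2ST p → ST p
  2ST⊆ST p ((Γ , Δ , safe , α , ⊢p) , terminating) =
    ( embedVarEnv Γ , embedOpEnv Δ , embedOpEnv-safe safe
    , toTier α , 1 , 1 , embedTyC Γ Δ ⊢p)
    , terminating

module OracleSeparation (𝒮 : Setting) where
  open Lang 𝒮
  open TierFacts 𝒮

  selfQuery : Program
  selfQuery = (0 := orc (var 0) (var 0)) return 0

  noOperators : OpEnv
  noOperators _ _ _ = ⊥

  selfQuery-ST : ST selfQuery
  selfQuery-ST = (safe , terminating)
    where
    safe : Safe selfQuery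
    safe = (λ _ → 0) , noOperators , (λ _ _ _ _ _ ()) , 0 , 1 , 0
         , A V (OR V V (s≤s z≤n) z≤n) z≤n

    terminating : Terminating selfQuery
    terminating φ μ = _ , _ , ex-assign (ev-orc ev-var ev-var) , refl

  selfQuery-¬2ST : ¬ 2ST selfQuery
  selfQuery-¬2ST ((_ , _ , _ , _ , A₂ _ ⊢orc _) , _) = ¬TyE₂-orc ⊢orc

lemma8p4 : (S : Setting) →
    let open Lang S in
      (∀ (p : Program) → 2ST p → ST p)
    × (∃[ p ] (ST p × ¬ 2ST p))
lemma8p4 S = TwoTierEmbedding.2ST⊆ST S
           , OracleSeparation.selfQuery S , OracleSeparation.selfQuery-ST S
           , OracleSeparation.selfQuery-¬2ST S
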